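{- Let $n\ge 3$ be odd. No solution of any peg solitaire problem on $\textsf{Triangle}(n)$ contains a move that is a maximal sweep, i.e. a sweep in which every hole of the board is either jumped over or landed in by the sweeping peg (equivalently, a sweep of length $3(n^2-1)/8$, the geometrically longest possible sweep on this board).
   Context: The board $\textsf{Triangle}(n)$ has the holes $(r,k)$ with integers $1\le k\le r\le n$. The six directions are $d\in\{(0,\pm1),(\pm1,0),(1,1),(-1,-1)\}$. A jump: if $h,h+d,h+2d$ are on the board, $h$ and $h+d$ hold pegs and $h+2d$ is empty, the peg at $h$ moves to $h+2d$ and the peg at $h+d$ is removed. A peg solitaire problem: start with pegs in all holes except one (the starting vacancy) and perform jumps until exactly one peg remains (at the finishing location); such a jump sequence is a solution. A move is a maximal block of consecutive jumps made by the same peg; a move consisting of $i$ jumps is called an $i$-sweep. -}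

module Defs where

open import Data.Nat using (ℕ)
open import Data.Integer using (ℤ; +_; _+_; _≤_; _≟_)
open import Data.Bool using (Bool; true; false; if_then_else_)
open import Data.Product using (_×_; _,_; ∃)
open import Data.Product.Properties using (≡-dec)
open import Data.List using (List; []; _∷_; _∷ʳ_)
open import Data.Unit using (⊤)
open import Relation.Binary.PropositionalEquality using (_≡_)
open import Relation.Nullary using (¬_)
open import Relation.Nullary.Decidable using (⌊_⌋)
open import Function.Bundles using (_⇔_)
import Data.List.Relation.Unary.Any
import Data.Sum

Pos : Set
Pos = ℤ × ℤ

_+ₚ_ : Pos → Pos → Pos
(a , b) +ₚ (c , d) = (a + c , b + d)

_==ₚ_ : Pos → Pos → Bool
p ==ₚ q = ⌊ ≡-dec _≟_ _≟_ p q ⌋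

OnBoard : ℕ → Pos → Set
OnBoard n (r , k) = (+ 1 ≤ k) × (k ≤ r) × (r ≤ + n)

data Dir : Set where
  d01 d0-1 d10 d-10 d11 d-1-1 : Dir

vec : Dir → Pos
vec d01   = (+ 0 , + 1)
vec d0-1  = (+ 0 , Data.Integer.-[1+ 0 ])
vec d10   = (+ 1 , + 0)
vec d-10  = (Data.Integer.-[1+ 0 ] , + 0)
vec d11   = (+ 1 , + 1)
vec d-1-1 = (Data.Integer.-[1+ 0 ] , Data.Integer.-[1+ 0 ])

Jump : Set
Jump = Pos × Dir

start : Jump → Pos
start (h , d) = h

over : Jump → Pos
over (h , d) = h +ₚ vec d

land : Jump → Pos
land (h , d) = (h +ₚ vec d) +ₚ vec d

-- A board state: true = peg, false = empty (only meaningful on the board).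
State : Set
State = Pos → Bool

initial : Pos → State
initial v p = if p ==ₚ v then false else true

apply : State → Jump → State
apply s j p =
  if p ==ₚ start j then false
  else if p ==ₚ over j then false
  else if p ==ₚ land j then true
  else s p

Legal : ℕ → State → Jump → Set
Legal n s j =
  OnBoard n (start j) × OnBoard n (over j) × OnBoard n (land j) ×
  (s (start j) ≡ true) × (s (over j) ≡ true) × (s (land j) ≡ false)

LegalSeq : ℕ → State → List Jump → Set
LegalSeq n s [] = ⊤
LegalSeq n s (j ∷ js) = Legal n s j × LegalSeq n (apply s j) js

run : State → List Jump → State
run s [] = s
run s (j ∷ js) = run (apply s j) js

IsSolution : ℕ → Pos → List Jump → Set
IsSolution n v js =
  OnBoard n v × LegalSeq n (initial v) js ×
  ∃ λ f → OnBoard n f × (∀ p → OnBoard n p → (run (initial v) js p ≡ true ⇔ p ≡ f))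

Chained : List Jump → Set
Chained [] = ⊤
Chained (j ∷ []) = ⊤
Chained (j ∷ j' ∷ js) = (land j ≡ start j') × Chained (j' ∷ js)

-- mv is a move of the jump sequence pre ++ mv ++ post: a maximal nonempty
-- block of consecutive jumps by the same peg.
IsMove : List Jump → List Jump → List Jump → Set
IsMove pre mv post =
  ¬ (mv ≡ []) × Chained mv ×
  (∀ pre' j → pre ≡ pre' ∷ʳ j → ¬ Chained (j ∷ mv)) ×
  (∀ j post' → post ≡ j ∷ post' → ¬ Chained (mv ∷ʳ j))

MaximalSweep : ℕ → List Jump → Set
MaximalSweep n mv =
  ∀ p → OnBoard n p → Data.List.Relation.Unary.Any.Any (λ j → (over j ≡ p) Data.Sum.⊎ (land j ≡ p)) mv

-- Colour each hole by the parities of its two coordinates. A jump moves a peg by twice a unit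
-- vector, so it keeps the peg's colour, while the hole jumped over has another colour; hence a
-- sweeping peg lands only in holes of its own colour. When a maximal sweep begins, every empty hole must be
-- landed in before it is jumped over, hence has the sweeper's colour, and every other full
-- hole must be jumped over. If some jump precedes the sweep, it left its start and the hole it
-- jumped over empty, and these have different colours. If the sweep is the first move, the
-- three corners, which can never be jumped over, would all have to be the sweeper's hole or
-- the initial vacancy.
module Submission where

open import Defs
open import Data.Nat using (ℕ; _≤_; _%_; suc; _+_; _<_; z≤n; s≤s; parity)
open import Data.List using (List; _++_; []; _∷_)
open import Relation.Binary.PropositionalEquality using (_≡_)
open import Relation.Nullary using (¬_)

import Data.Nat.Properties as ℕₚ
open import Data.Integer as ℤ using (ℤ; +_; -[1+_]; ∣_∣; _-_; -_; +≤+)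
import Data.Integer.Properties as ℤₚ
open import Data.Parity.Base using (Parity; _⁻¹)
open import Data.Parity.Properties using (⁻¹-selfInverse; ⁻¹-involutive; p≢p⁻¹; suc-homo-⁻¹)
open import Data.Bool using (Bool; true; false)
open import Data.Product using (_×_; _,_; proj₁; proj₂; ∃)
open import Data.Product.Properties using (≡-dec)
open import Data.Sum using (_⊎_; inj₁; inj₂)
open import Data.Empty using (⊥; ⊥-elim)
open import Data.Unit using (tt)
open import Data.List.Relation.Unary.Any using (Any; here; there)
open import Data.List.Relation.Unary.All as All using (All; []; _∷_)
open import Function using (_∘_)
open import Relation.Nullary using (Dec; yes; no)
open import Relation.Nullary.Decidable using (_⊎-dec_; isYes≗does; dec-true; dec-false)
open import Relation.Binary.PropositionalEquality using (_≢_; refl; sym; trans; cong; cong₂; subst; module ≡-Reasoning)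
open ≡-Reasoning

_≟ₚ_ : (p q : Pos) → Dec (p ≡ q)
_≟ₚ_ = ≡-dec ℤ._≟_ ℤ._≟_

==ₚ-refl : ∀ p → (p ==ₚ p) ≡ true
==ₚ-refl p = trans (isYes≗does (p ≟ₚ p)) (dec-true (p ≟ₚ p) refl)

==ₚ-false : ∀ {p q} → p ≢ q → (p ==ₚ q) ≡ false
==ₚ-false {p} {q} p≢q = trans (isYes≗does (p ≟ₚ q)) (dec-false (p ≟ₚ q) p≢q)

initial-full : ∀ {v p} → p ≢ v → initial v p ≡ true
initial-full {v} {p} p≢v rewrite ==ₚ-false p≢v = refl

apply-start : ∀ S j → apply S j (start j) ≡ false
apply-start S j rewrite ==ₚ-refl (start j) = refl

apply-over : ∀ S j → apply S j (over j) ≡ false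
apply-over S j with over j ==ₚ start j
... | true  = refl
... | false rewrite ==ₚ-refl (over j) = refl

apply-elsewhere : ∀ S j {p} → p ≢ start j → p ≢ over j → p ≢ land j → apply S j p ≡ S p
apply-elsewhere S j p≢start p≢over p≢land
  rewrite ==ₚ-false p≢start | ==ₚ-false p≢over | ==ₚ-false p≢land = refl

LegalSeq-++⁻ : ∀ {n} S xs {ys} → LegalSeq n S (xs ++ ys) → LegalSeq n S xs × LegalSeq n (run S xs) ys
LegalSeq-++⁻ S []       legal           = tt , legal
LegalSeq-++⁻ S (x ∷ xs) (x-ok , legal) =
  let xs-ok , ys-ok = LegalSeq-++⁻ (apply S x) xs legal in (x-ok , xs-ok) , ys-ok

vacated-by-last-jump : ∀ {n} S j js → LegalSeq n S (j ∷ js) →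
  ∃ λ i → OnBoard n (start i) × OnBoard n (over i) ×
          run S (j ∷ js) (start i) ≡ false × run S (j ∷ js) (over i) ≡ false
vacated-by-last-jump S j []        ((start∈ , over∈ , _) , _) =
  j , start∈ , over∈ , apply-start S j , apply-over S j
vacated-by-last-jump S j (j' ∷ js) (_ , legal) = vacated-by-last-jump (apply S j) j' js legal

parityℤ : ℤ → Parity
parityℤ i = parity ∣ i ∣

parity-suc : ∀ m → parity (suc m) ≡ parity m ⁻¹
parity-suc m = sym (⁻¹-selfInverse (suc-homo-⁻¹ m))

parityℤ-+1 : ∀ i → parityℤ (i ℤ.+ + 1) ≡ parityℤ i ⁻¹
parityℤ-+1 (+ m) rewrite ℕₚ.+-comm m 1 = parity-suc m
parityℤ-+1 -[1+ 0 ]     = refl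
parityℤ-+1 -[1+ suc m ] = parity-suc m

parityℤ-+-1 : ∀ i → parityℤ (i ℤ.+ -[1+ 0 ]) ≡ parityℤ i ⁻¹
parityℤ-+-1 (+ 0)     = refl
parityℤ-+-1 (+ suc m) = sym (suc-homo-⁻¹ m)
parityℤ-+-1 -[1+ m ] rewrite ℕₚ.+-identityʳ m = sym (suc-homo-⁻¹ m)

parityℤ-+0 : ∀ i → parityℤ (i ℤ.+ + 0) ≡ parityℤ i
parityℤ-+0 i = cong parityℤ (ℤₚ.+-identityʳ i)

colour : Pos → Parity × Parity
colour (r , k) = parityℤ r , parityℤ k

recolour : Dir → Parity × Parity → Parity × Parity
recolour d01   (a , b) = a , b ⁻¹
recolour d0-1  (a , b) = a , b ⁻¹
recolour d10   (a , b) = a ⁻¹ , b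
recolour d-10  (a , b) = a ⁻¹ , b
recolour d11   (a , b) = a ⁻¹ , b ⁻¹
recolour d-1-1 (a , b) = a ⁻¹ , b ⁻¹

colour-step : ∀ p d → colour (p +ₚ vec d) ≡ recolour d (colour p)
colour-step (r , k) d01   = cong₂ _,_ (parityℤ-+0 r) (parityℤ-+1 k)
colour-step (r , k) d0-1  = cong₂ _,_ (parityℤ-+0 r) (parityℤ-+-1 k)
colour-step (r , k) d10   = cong₂ _,_ (parityℤ-+1 r) (parityℤ-+0 k)
colour-step (r , k) d-10  = cong₂ _,_ (parityℤ-+-1 r) (parityℤ-+0 k)
colour-step (r , k) d11   = cong₂ _,_ (parityℤ-+1 r) (parityℤ-+1 k)
colour-step (r , k) d-1-1 = cong₂ _,_ (parityℤ-+-1 r) (parityℤ-+-1 k)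

recolour-involutive : ∀ d c → recolour d (recolour d c) ≡ c
recolour-involutive d01   (a , b) = cong (a ,_) (⁻¹-involutive b)
recolour-involutive d0-1  (a , b) = cong (a ,_) (⁻¹-involutive b)
recolour-involutive d10   (a , b) = cong (_, b) (⁻¹-involutive a)
recolour-involutive d-10  (a , b) = cong (_, b) (⁻¹-involutive a)
recolour-involutive d11   (a , b) = cong₂ _,_ (⁻¹-involutive a) (⁻¹-involutive b)
recolour-involutive d-1-1 (a , b) = cong₂ _,_ (⁻¹-involutive a) (⁻¹-involutive b)

recolour-changes : ∀ d c → recolour d c ≢ c
recolour-changes d01   (a , b) = p≢p⁻¹ b ∘ sym ∘ cong proj₂
recolour-changes d0-1  (a , b) = p≢p⁻¹ b ∘ sym ∘ cong proj₂
recolour-changes d10   (a , b) = p≢p⁻¹ a ∘ sym ∘ cong proj₁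
recolour-changes d-10  (a , b) = p≢p⁻¹ a ∘ sym ∘ cong proj₁
recolour-changes d11   (a , b) = p≢p⁻¹ a ∘ sym ∘ cong proj₁
recolour-changes d-1-1 (a , b) = p≢p⁻¹ a ∘ sym ∘ cong proj₁

colour-land : ∀ j → colour (land j) ≡ colour (start j)
colour-land (h , d) = begin
  colour ((h +ₚ vec d) +ₚ vec d)       ≡⟨ colour-step (h +ₚ vec d) d ⟩
  recolour d (colour (h +ₚ vec d))     ≡⟨ cong (recolour d) (colour-step h d) ⟩
  recolour d (recolour d (colour h))   ≡⟨ recolour-involutive d (colour h) ⟩
  colour h                             ∎

colour-over : ∀ j → colour (over j) ≢ colour (start j)
colour-over (h , d) e = recolour-changes d (colour h) (trans (sym (colour-step h d)) e)

starts-share-colour : ∀ j js → Chained (j ∷ js) → All (λ i → colour (start i) ≡ colour (start j)) (j ∷ js)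
starts-share-colour j []        _                       = refl ∷ []
starts-share-colour j (j' ∷ js) (land≡start' , chained) =
  refl ∷ All.map (λ e → trans e same) (starts-share-colour j' js chained)
  where
  same : colour (start j') ≡ colour (start j)
  same = trans (cong colour (sym land≡start')) (colour-land j)

landed-colour : ∀ {j js p} → Chained (j ∷ js) → Any (λ i → land i ≡ p) (j ∷ js) → colour p ≡ colour (start j)
landed-colour {j} {js} chained =
  All.lookupWith (λ {i} same land≡p → trans (cong colour (sym land≡p)) (trans (colour-land i) same))
                 (starts-share-colour j js chained)

_-ₚ_ : Pos → Pos → Pos
(a , b) -ₚ (c , d) = (a - c , b - d)

p+ₚu-ₚu≡p : ∀ p u → (p +ₚ u) -ₚ u ≡ p
p+ₚu-ₚu≡p (a , b) (c , d) = cong₂ _,_ (x+y-y≡x a c) (x+y-y≡x b d)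
  where
  x+y-y≡x : ∀ x y → (x ℤ.+ y) - y ≡ x
  x+y-y≡x x y = begin
    (x ℤ.+ y) ℤ.+ - y   ≡⟨ ℤₚ.+-assoc x y (- y) ⟩
    x ℤ.+ (y ℤ.+ - y)   ≡⟨ cong (ℤ._+_ x) (ℤₚ.+-inverseʳ y) ⟩
    x ℤ.+ + 0           ≡⟨ ℤₚ.+-identityʳ x ⟩
    x                   ∎

Jumpable : ℕ → Pos → Set
Jumpable n c = ∃ λ d → OnBoard n (c -ₚ vec d) × OnBoard n (c +ₚ vec d)

legal-jumps-jumpable : ∀ {n} S js → LegalSeq n S js → All (λ j → Jumpable n (over j)) js
legal-jumps-jumpable S []             _                                 = []
legal-jumps-jumpable S ((h , d) ∷ js) ((start∈ , _ , land∈ , _) , legal) =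
  (d , subst (OnBoard _) (sym (p+ₚu-ₚu≡p h (vec d))) start∈ , land∈) ∷ legal-jumps-jumpable _ js legal

beyond : ∀ {m n} → m < n → ¬ (+ n ℤ.≤ + m)
beyond m<n (+≤+ n≤m) = ℕₚ.<⇒≱ m<n n≤m

0<1 : 0 < 1
0<1 = ℕₚ.n<1+n 0

n<n+1 : ∀ n → n < n + 1
n<n+1 n = ℕₚ.m<m+n n 0<1

apex : Pos
apex = + 1 , + 1

left right : ℕ → Pos
left  n = + n , + 1
right n = + n , + n

apex-unjumpable : ∀ n → ¬ Jumpable n apex
apex-unjumpable n (d01   , _ , (_ , k≤r , _)) = beyond (ℕₚ.n<1+n 1) k≤r
apex-unjumpable n (d0-1  , _ , (1≤k , _))     = beyond 0<1 1≤k
apex-unjumpable n (d10   , (_ , k≤r , _) , _) = beyond 0<1 k≤r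
apex-unjumpable n (d-10  , _ , (_ , k≤r , _)) = beyond 0<1 k≤r
apex-unjumpable n (d11   , (1≤k , _) , _)     = beyond 0<1 1≤k
apex-unjumpable n (d-1-1 , _ , (1≤k , _))     = beyond 0<1 1≤k

left-unjumpable : ∀ n → ¬ Jumpable n (left n)
left-unjumpable n (d01   , (1≤k , _) , _)     = beyond 0<1 1≤k
left-unjumpable n (d0-1  , _ , (1≤k , _))     = beyond 0<1 1≤k
left-unjumpable n (d10   , _ , (_ , _ , r≤n)) = beyond (n<n+1 n) r≤n
left-unjumpable n (d-10  , (_ , _ , r≤n) , _) = beyond (n<n+1 n) r≤n
left-unjumpable n (d11   , _ , (_ , _ , r≤n)) = beyond (n<n+1 n) r≤n
left-unjumpable n (d-1-1 , _ , (1≤k , _))     = beyond 0<1 1≤k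

right-unjumpable : ∀ n → ¬ Jumpable n (right n)
right-unjumpable n (d01   , _ , (_ , k≤r , _)) = beyond (ℕₚ.+-monoʳ-< n 0<1) k≤r
right-unjumpable n (d0-1  , (_ , k≤r , _) , _) = beyond (ℕₚ.+-monoʳ-< n 0<1) k≤r
right-unjumpable n (d10   , _ , (_ , _ , r≤n)) = beyond (n<n+1 n) r≤n
right-unjumpable n (d-10  , (_ , _ , r≤n) , _) = beyond (n<n+1 n) r≤n
right-unjumpable n (d11   , _ , (_ , _ , r≤n)) = beyond (n<n+1 n) r≤n
right-unjumpable n (d-1-1 , (_ , _ , r≤n) , _) = beyond (n<n+1 n) r≤n

Touches : Pos → Jump → Set
Touches p j = over j ≡ p ⊎ land j ≡ p

touches? : ∀ p j → Dec (Touches p j)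
touches? p j = (over j ≟ₚ p) ⊎-dec (land j ≟ₚ p)

-- How a move first reaches p: a hole holding a peg can only be jumped over, an empty one only
-- landed in.
Visit : Bool → Pos → Jump → Set
Visit true  p j = over j ≡ p
Visit false p j = land j ≡ p

visit-now : ∀ {n S j p} → Legal n S j → Touches p j → Visit (S p) p j
visit-now {j = j} (_ , _ , _ , _ , over-full , _) (inj₁ refl) =
  subst (λ b → Visit b (over j) j) (sym over-full) refl
visit-now {j = j} (_ , _ , _ , _ , _ , land-empty) (inj₂ refl) =
  subst (λ b → Visit b (land j) j) (sym land-empty) refl

first-visit : ∀ {n} S j js p → LegalSeq n S (j ∷ js) → Chained (j ∷ js) → p ≢ start j →
              Any (Touches p) (j ∷ js) → Any (Visit (S p) p) (j ∷ js)
first-visit S j js p (j-ok , legal) chained p≢start touched with touches? p j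
... | yes now = here (visit-now j-ok now)
first-visit S j js p _ _ _ (here now) | no ¬now = ⊥-elim (¬now now)
first-visit S j (j' ∷ js) p (_ , legal) (land≡start' , chained) p≢start (there later) | no ¬now =
  there (subst (λ b → Any (Visit b p) (j' ∷ js)) unchanged
               (first-visit (apply S j) j' js p legal chained p≢start' later))
  where
  p≢start' : p ≢ start j'
  p≢start' p≡start' = ¬now (inj₂ (trans land≡start' (sym p≡start')))
  unchanged : apply S j p ≡ S p
  unchanged = apply-elsewhere S j p≢start (¬now ∘ inj₁ ∘ sym) (¬now ∘ inj₂ ∘ sym)

module MaximalSweepFrom {n} (S : State) (j₁ : Jump) (js : List Jump)
  (legal : LegalSeq n S (j₁ ∷ js)) (chained : Chained (j₁ ∷ js)) (maximal : MaximalSweep n (j₁ ∷ js)) where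

  visited : ∀ q → OnBoard n q → q ≢ start j₁ → Any (Visit (S q) q) (j₁ ∷ js)
  visited q q∈board q≢start = first-visit S j₁ js q legal chained q≢start (maximal q q∈board)

  empty-hole-colour : ∀ q → OnBoard n q → S q ≡ false → colour q ≡ colour (start j₁)
  empty-hole-colour q q∈board empty with q ≟ₚ start j₁
  ... | yes refl   = refl
  ... | no q≢start =
    landed-colour chained (subst (λ b → Any (Visit b q) (j₁ ∷ js)) empty (visited q q∈board q≢start))

  full-hole-jumpable : ∀ q → OnBoard n q → q ≢ start j₁ → S q ≡ true → Jumpable n q
  full-hole-jumpable q q∈board q≢start full =
    All.lookupWith (λ jumpable over≡q → subst (Jumpable n) over≡q jumpable)
                   (legal-jumps-jumpable S (j₁ ∷ js) legal)
                   (subst (λ b → Any (Visit b q) (j₁ ∷ js)) full (visited q q∈board q≢start))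

no-maximal-sweep-after-jump : ∀ {n} S j pre j₁ js → LegalSeq n S (j ∷ pre) →
  LegalSeq n (run S (j ∷ pre)) (j₁ ∷ js) → Chained (j₁ ∷ js) → ¬ MaximalSweep n (j₁ ∷ js)
no-maximal-sweep-after-jump S j pre j₁ js legal-pre legal chained maximal
  with vacated-by-last-jump S j pre legal-pre
... | i , start∈ , over∈ , start-empty , over-empty =
  colour-over i (trans (empty-hole-colour (over i) over∈ over-empty)
                       (sym (empty-hole-colour (start i) start∈ start-empty)))
  where open MaximalSweepFrom (run S (j ∷ pre)) j₁ js legal chained maximal

three-distinct-not-in-pair : ∀ {A : Set} {a b c x y : A} → a ≢ b → a ≢ c → b ≢ c →
                             a ≡ x ⊎ a ≡ y → b ≡ x ⊎ b ≡ y → c ≡ x ⊎ c ≡ y → ⊥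
three-distinct-not-in-pair a≢b _ _ (inj₁ a≡x) (inj₁ b≡x) _ = a≢b (trans a≡x (sym b≡x))
three-distinct-not-in-pair a≢b _ _ (inj₂ a≡y) (inj₂ b≡y) _ = a≢b (trans a≡y (sym b≡y))
three-distinct-not-in-pair _ a≢c _ (inj₁ a≡x) _ (inj₁ c≡x) = a≢c (trans a≡x (sym c≡x))
three-distinct-not-in-pair _ a≢c _ (inj₂ a≡y) _ (inj₂ c≡y) = a≢c (trans a≡y (sym c≡y))
three-distinct-not-in-pair _ _ b≢c _ (inj₁ b≡x) (inj₁ c≡x) = b≢c (trans b≡x (sym c≡x))
three-distinct-not-in-pair _ _ b≢c _ (inj₂ b≡y) (inj₂ c≡y) = b≢c (trans b≡y (sym c≡y))

+-≢-1 : ∀ {n} → 1 < n → + n ≢ + 1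
+-≢-1 (s≤s (s≤s _)) ()

first-move-not-maximal : ∀ {n} v j₁ js → 1 < n → LegalSeq n (initial v) (j₁ ∷ js) → Chained (j₁ ∷ js) →
                         ¬ MaximalSweep n (j₁ ∷ js)
first-move-not-maximal {n} v j₁ js 1<n legal chained maximal =
  three-distinct-not-in-pair (n≢1 ∘ sym ∘ cong proj₁) (n≢1 ∘ sym ∘ cong proj₁) (n≢1 ∘ sym ∘ cong proj₂)
    (start-or-vacancy apex      (ℤₚ.≤-refl , ℤₚ.≤-refl , 1≤n) (apex-unjumpable n))
    (start-or-vacancy (left n)  (ℤₚ.≤-refl , 1≤n , ℤₚ.≤-refl) (left-unjumpable n))
    (start-or-vacancy (right n) (1≤n , ℤₚ.≤-refl , ℤₚ.≤-refl) (right-unjumpable n))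
  where
  open MaximalSweepFrom (initial v) j₁ js legal chained maximal
  n≢1 : + n ≢ + 1
  n≢1 = +-≢-1 1<n
  1≤n : + 1 ℤ.≤ + n
  1≤n = +≤+ (ℕₚ.<⇒≤ 1<n)
  start-or-vacancy : ∀ c → OnBoard n c → ¬ Jumpable n c → c ≡ start j₁ ⊎ c ≡ v
  start-or-vacancy c c∈board unjumpable with c ≟ₚ start j₁ | c ≟ₚ v
  ... | yes c≡start | _       = inj₁ c≡start
  ... | no _        | yes c≡v = inj₂ c≡v
  ... | no c≢start  | no c≢v  = ⊥-elim (unjumpable (full-hole-jumpable c c∈board c≢start (initial-full c≢v)))

mainTheorem3 : (n : ℕ) → 3 ≤ n → n % 2 ≡ 1 →
    (v : Pos) (js : List Jump) → IsSolution n v js →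
    (pre mv post : List Jump) → js ≡ pre ++ (mv ++ post) → IsMove pre mv post →
    ¬ MaximalSweep n mv
mainTheorem3 n _ _ v js _ pre [] post _ (mv≢[] , _) = ⊥-elim (mv≢[] refl)
mainTheorem3 n 3≤n _ v js (_ , legal , _) pre (j₁ ∷ mv) post refl (_ , chained , _)
  with LegalSeq-++⁻ (initial v) pre legal
... | legal-pre , legal-rest with pre | proj₁ (LegalSeq-++⁻ _ (j₁ ∷ mv) legal-rest)
...   | []        | legal-move = first-move-not-maximal v j₁ mv (ℕₚ.≤-trans (s≤s (s≤s z≤n)) 3≤n) legal-move chained
...   | j ∷ pre'  | legal-move = no-maximal-sweep-after-jump (initial v) j pre' j₁ mv legal-pre legal-move chained
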